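{- Let $n\geq 4$, let $G_n=\mathbb{Z}_n\times\mathbb{Z}_n$, let $S=\{(i,0),(0,i),(i,i): 1\leq i\leq n-1\}\subset G_n$, and let $\Gamma(n)$ be the Cayley graph $\mathrm{Cay}(G_n;S)$, i.e. the graph with vertex set $G_n$ in which $g$ and $h$ are adjacent iff $h-g\in S$. Let $C_1=\{(i,0):1\leq i\leq n-1\}$, $C_2=\{(0,i):1\leq i\leq n-1\}$, $C_3=\{(i,i):1\leq i\leq n-1\}$. Let $f$ be an automorphism of $\Gamma(n)$ with $f(0,0)=(0,0)$ and $f(C_1)=C_1$, $f(C_2)=C_2$, $f(C_3)=C_3$. Then there is a unit $u\in\mathbb{Z}_n^*$ such that $f=\psi_u$, where $\psi_u(i,j)=(ui,uj)$ for all $(i,j)\in G_n$.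
   Context: $\mathbb{Z}_n^*$ denotes the group of units of the ring $\mathbb{Z}_n$; all arithmetic is modulo $n$. For every $u\in\mathbb{Z}_n^*$ the map $\psi_u$ is an automorphism of $\Gamma(n)$. -}

module Defs where

open import Data.Nat using (ℕ; zero; suc; _+_; _*_; _∸_; NonZero)
open import Data.Nat.DivMod using (_%_; m%n<n)
open import Data.Fin using (Fin; toℕ; fromℕ<)
open import Data.Product using (_×_; _,_; Σ; ∃; ∃-syntax)
open import Data.Sum using (_⊎_)
open import Relation.Binary.PropositionalEquality using (_≡_)
open import Relation.Nullary using (¬_)
open import Function.Bundles using (_⇔_)
open import Function.Definitions using (Bijective)

ℤ_ : ℕ → Set
ℤ n = Fin n

module _ (n : ℕ) .{{_ : NonZero n}} where

  [_] : ℕ → ℤ n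
  [ m ] = fromℕ< (m%n<n m n)

  zero' : ℤ n
  zero' = [ 0 ]

  one' : ℤ n
  one' = [ 1 ]

  _+ₙ_ : ℤ n → ℤ n → ℤ n
  a +ₙ b = [ toℕ a + toℕ b ]

  _*ₙ_ : ℤ n → ℤ n → ℤ n
  a *ₙ b = [ toℕ a * toℕ b ]

  -ₙ_ : ℤ n → ℤ n
  -ₙ a = [ n ∸ toℕ a ]

  _-ₙ_ : ℤ n → ℤ n → ℤ n
  a -ₙ b = a +ₙ (-ₙ b)

  IsUnit : ℤ n → Set
  IsUnit u = ∃[ v ] (u *ₙ v ≡ one')

  G : Set
  G = ℤ n × ℤ n

  origin : G
  origin = (zero' , zero')

  _-G_ : G → G → G
  (a , b) -G (c , d) = (a -ₙ c , b -ₙ d)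

  C₁ C₂ C₃ : G → Set
  C₁ g = ∃[ i ] (¬ i ≡ zero' × g ≡ (i , zero'))
  C₂ g = ∃[ i ] (¬ i ≡ zero' × g ≡ (zero' , i))
  C₃ g = ∃[ i ] (¬ i ≡ zero' × g ≡ (i , i))

  InS : G → Set
  InS g = C₁ g ⊎ C₂ g ⊎ C₃ g

  Adj : G → G → Set
  Adj g h = InS (h -G g)

  IsAut : (G → G) → Set
  IsAut f = Bijective _≡_ _≡_ f × (∀ g h → Adj g h ⇔ Adj (f g) (f h))

  MapsOnto : (G → G) → (G → Set) → Set
  MapsOnto f C = (∀ g → C g → C (f g)) × (∀ h → C h → ∃[ g ] (C g × f g ≡ h))

  ψ : ℤ n → G → G
  ψ u (i , j) = (u *ₙ i , u *ₙ j)

{-# OPTIONS --safe #-}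
-- Write f (i , 0) = (σ i , 0). Since (i , i) is adjacent to both (i , 0) and (0 , i), f (i , i) = (σ i , σ i)
-- and f (0 , i) = (0 , σ i). The points off the axes and the diagonal are exactly the non-neighbours of
-- the origin, so f permutes them; such a point (a , b) is adjacent to (a , a) and (b , b), hence f (a , b)
-- is (σ a , σ b) or (σ b , σ a). In the first case the diagonal edge from (a - b , 0) gives
-- σ a = σ (a - b) + σ b. The second case forces b = a + a; then for c ∉ {0 , a , b}, which exists as n ≥ 4,
-- f (a , c) = (σ a , σ c) (the other case would give c = a + a = b), and the image of the vertical edge
-- from (a , b) to (a , c) forces σ c = 0.
-- Hence σ (x + 1) = σ x + σ 1, so σ is multiplication by u = σ 1, a unit since some (i , 0) maps to (1 , 0).
module Submission where

open import Algebra.Bundles using (Ring; CommutativeRing)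
open import Algebra.Consequences.Propositional using (comm∧idˡ⇒id; comm∧invˡ⇒inv; comm∧distrˡ⇒distrʳ)
open import Algebra.Core using (Op₁; Op₂)
open import Algebra.Definitions
import Algebra.Properties.Ring as RingProperties
open import Algebra.Structures using (IsCommutativeRing)
open import Data.Empty using (⊥-elim)
open import Data.Fin using (toℕ)
open import Data.Fin.Properties using (toℕ-fromℕ<; toℕ-injective; toℕ<n; _≟_)
open import Data.Nat using (ℕ; zero; suc; _≤_; _<_; z<s; s<s; NonZero)
open import Data.Nat.DivMod using (_%_; %-distribˡ-+; %-distribˡ-*; [m+n]%n≡m%n; m<n⇒m%n≡m)
import Data.Nat.Properties as ℕ
open import Data.Product using (_×_; _,_; proj₁; proj₂; ∃-syntax)
open import Data.Sum using (_⊎_; inj₁; inj₂)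
open import Defs
open import Function.Base using (_∘_)
open import Function.Bundles using (Equivalence)
open import Level using (0ℓ)
open import Relation.Binary.Definitions using (DecidableEquality)
open import Relation.Binary.PropositionalEquality
  using (_≡_; _≢_; refl; sym; trans; cong; cong₂; subst; ≢-sym; module ≡-Reasoning)
open import Relation.Binary.PropositionalEquality.Algebra using (isMagma)
import Relation.Binary.Reasoning.Setoid as SetoidReasoning
open import Relation.Nullary using (¬_; yes; no)

avoid-two : ∀ {a} {A : Set a} → DecidableEquality A → {x y z : A} → x ≢ y → x ≢ z → y ≢ z →
            ∀ u v → (x ≢ u × x ≢ v) ⊎ (y ≢ u × y ≢ v) ⊎ (z ≢ u × z ≢ v)
avoid-two _≟_ {x} {y} x≢y x≢z y≢z u v with x ≟ u | x ≟ v | y ≟ u | y ≟ v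
... | no x≢u   | no x≢v   | _        | _        = inj₁ (x≢u , x≢v)
... | yes refl | _        | _        | no y≢v   = inj₂ (inj₁ (≢-sym x≢y , y≢v))
... | yes refl | _        | _        | yes refl = inj₂ (inj₂ (≢-sym x≢z , ≢-sym y≢z))
... | no _     | yes refl | no y≢u   | _        = inj₂ (inj₁ (y≢u , ≢-sym x≢y))
... | no _     | yes refl | yes refl | _        = inj₂ (inj₂ (≢-sym y≢z , ≢-sym x≢z))

module DifferenceProperties {c ℓ} (R : Ring c ℓ) where
  open Ring R hiding (refl; sym; trans)
  open RingProperties R
  open SetoidReasoning setoid

  x-y≈x-z⇒y≈z : ∀ x y z → x - y ≈ x - z → y ≈ z
  x-y≈x-z⇒y≈z x y z eq = -‿injective (+-cancelˡ x (- y) (- z) eq)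

  x-0≈x : ∀ x → x - 0# ≈ x
  x-0≈x x = begin
    x + - 0#  ≈⟨ +-congˡ -0#≈0# ⟩
    x + 0#    ≈⟨ +-identityʳ x ⟩
    x         ∎

  x-y≈x⇒y≈0 : ∀ x y → x - y ≈ x → y ≈ 0#
  x-y≈x⇒y≈0 x y eq = x-y≈x-z⇒y≈z x y 0# (begin
    x - y   ≈⟨ eq ⟩
    x       ≈⟨ x-0≈x x ⟨
    x - 0#  ∎)

  x-y≈z⇒x≈z+y : ∀ x y z → x - y ≈ z → x ≈ z + y
  x-y≈z⇒x≈z+y x y z eq = begin
    x          ≈⟨ //-rightDividesˡ y x ⟨
    x - y + y  ≈⟨ +-congʳ eq ⟩
    z + y      ∎

  x-[x-y]≈y : ∀ x y → x - (x - y) ≈ y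
  x-[x-y]≈y x y = begin
    x - (x - y)  ≈⟨ +-congˡ (⁻¹-anti-homo‿- x y) ⟩
    x + (y - x)  ≈⟨ +-comm x (y - x) ⟩
    y - x + x    ≈⟨ //-rightDividesˡ x y ⟩
    y            ∎

module ZMod (n : ℕ) .{{_ : NonZero n}} where
  open Data.Nat using (_+_; _*_; _∸_)

  ⟦_⟧ : ℕ → ℤ n
  ⟦_⟧ = [_] n

  toℕ-⟦⟧ : ∀ m → toℕ ⟦ m ⟧ ≡ m % n
  toℕ-⟦⟧ m = toℕ-fromℕ< _

  ⟦⟧-cong : ∀ {a b} → a % n ≡ b % n → ⟦ a ⟧ ≡ ⟦ b ⟧
  ⟦⟧-cong {a} {b} eq = toℕ-injective (trans (toℕ-⟦⟧ a) (trans eq (sym (toℕ-⟦⟧ b))))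

  ⟦⟧-toℕ : ∀ x → ⟦ toℕ x ⟧ ≡ x
  ⟦⟧-toℕ x = toℕ-injective (trans (toℕ-⟦⟧ (toℕ x)) (m<n⇒m%n≡m (toℕ<n x)))

  ⟦⟧-injective : ∀ {i j} → i < n → j < n → ⟦ i ⟧ ≡ ⟦ j ⟧ → i ≡ j
  ⟦⟧-injective {i} {j} i<n j<n eq = begin
    i         ≡⟨ m<n⇒m%n≡m i<n ⟨
    i % n     ≡⟨ toℕ-⟦⟧ i ⟨
    toℕ ⟦ i ⟧ ≡⟨ cong toℕ eq ⟩
    toℕ ⟦ j ⟧ ≡⟨ toℕ-⟦⟧ j ⟩
    j % n     ≡⟨ m<n⇒m%n≡m j<n ⟩
    j         ∎
    where open ≡-Reasoning

  module Induced (_∙_ : Op₂ ℕ) (%-distrib : ∀ a b → (a ∙ b) % n ≡ ((a % n) ∙ (b % n)) % n) where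

    infixl 6 _⊙_
    _⊙_ : Op₂ (ℤ n)
    x ⊙ y = ⟦ toℕ x ∙ toℕ y ⟧

    ⟦⟧-homo : ∀ a b → ⟦ a ⟧ ⊙ ⟦ b ⟧ ≡ ⟦ a ∙ b ⟧
    ⟦⟧-homo a b = ⟦⟧-cong (trans (cong₂ (λ p q → (p ∙ q) % n) (toℕ-⟦⟧ a) (toℕ-⟦⟧ b)) (sym (%-distrib a b)))

    ⟦⟧-homoˡ : ∀ a y → ⟦ a ⟧ ⊙ y ≡ ⟦ a ∙ toℕ y ⟧
    ⟦⟧-homoˡ a y = trans (cong (⟦ a ⟧ ⊙_) (sym (⟦⟧-toℕ y))) (⟦⟧-homo a (toℕ y))

    ⟦⟧-homoʳ : ∀ x b → x ⊙ ⟦ b ⟧ ≡ ⟦ toℕ x ∙ b ⟧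
    ⟦⟧-homoʳ x b = trans (cong (_⊙ ⟦ b ⟧) (sym (⟦⟧-toℕ x))) (⟦⟧-homo (toℕ x) b)

    ⊙-assoc : Associative _≡_ _∙_ → Associative _≡_ _⊙_
    ⊙-assoc ∙-assoc x y z = begin
      ⟦ toℕ x ∙ toℕ y ⟧ ⊙ z          ≡⟨ ⟦⟧-homoˡ (toℕ x ∙ toℕ y) z ⟩
      ⟦ (toℕ x ∙ toℕ y) ∙ toℕ z ⟧    ≡⟨ cong ⟦_⟧ (∙-assoc (toℕ x) (toℕ y) (toℕ z)) ⟩
      ⟦ toℕ x ∙ (toℕ y ∙ toℕ z) ⟧    ≡⟨ ⟦⟧-homoʳ x (toℕ y ∙ toℕ z) ⟨
      x ⊙ ⟦ toℕ y ∙ toℕ z ⟧          ∎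
      where open ≡-Reasoning

    ⊙-comm : Commutative _≡_ _∙_ → Commutative _≡_ _⊙_
    ⊙-comm ∙-comm x y = cong ⟦_⟧ (∙-comm (toℕ x) (toℕ y))

    ⊙-identityˡ : ∀ {e} → LeftIdentity _≡_ e _∙_ → LeftIdentity _≡_ ⟦ e ⟧ _⊙_
    ⊙-identityˡ {e} ∙-identityˡ x = begin
      ⟦ e ⟧ ⊙ x          ≡⟨ ⟦⟧-homoˡ e x ⟩
      ⟦ e ∙ toℕ x ⟧      ≡⟨ cong ⟦_⟧ (∙-identityˡ (toℕ x)) ⟩
      ⟦ toℕ x ⟧          ≡⟨ ⟦⟧-toℕ x ⟩
      x                  ∎
      where open ≡-Reasoning

  private
    module Add = Induced _+_ (λ a b → %-distribˡ-+ a b n)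
    module Mul = Induced _*_ (λ a b → %-distribˡ-* a b n)

  open Add using () renaming (_⊙_ to _⊕_)
  open Mul using () renaming (_⊙_ to _⊛_)

  ⊝_ : Op₁ (ℤ n)
  ⊝_ = -ₙ_ n

  ⊕-inverseˡ : LeftInverse _≡_ ⟦ 0 ⟧ ⊝_ _⊕_
  ⊕-inverseˡ x = begin
    ⟦ n ∸ toℕ x ⟧ ⊕ x        ≡⟨ Add.⟦⟧-homoˡ (n ∸ toℕ x) x ⟩
    ⟦ n ∸ toℕ x + toℕ x ⟧    ≡⟨ cong ⟦_⟧ (ℕ.m∸n+n≡m (ℕ.<⇒≤ (toℕ<n x))) ⟩
    ⟦ n ⟧                    ≡⟨ ⟦⟧-cong ([m+n]%n≡m%n 0 n) ⟩
    ⟦ 0 ⟧                    ∎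
    where open ≡-Reasoning

  ⊛-distribˡ-⊕ : _DistributesOverˡ_ _≡_ _⊛_ _⊕_
  ⊛-distribˡ-⊕ x y z = begin
    x ⊛ ⟦ toℕ y + toℕ z ⟧                  ≡⟨ Mul.⟦⟧-homoʳ x (toℕ y + toℕ z) ⟩
    ⟦ toℕ x * (toℕ y + toℕ z) ⟧            ≡⟨ cong ⟦_⟧ (ℕ.*-distribˡ-+ (toℕ x) (toℕ y) (toℕ z)) ⟩
    ⟦ toℕ x * toℕ y + toℕ x * toℕ z ⟧      ≡⟨ Add.⟦⟧-homo (toℕ x * toℕ y) (toℕ x * toℕ z) ⟨
    (x ⊛ y) ⊕ (x ⊛ z)                      ∎
    where open ≡-Reasoning

  isCommutativeRing : IsCommutativeRing _≡_ (_+ₙ_ n) (_*ₙ_ n) (-ₙ_ n) (zero' n) (one' n)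
  isCommutativeRing = record
    { isRing = record
      { +-isAbelianGroup = record
        { isGroup = record
          { isMonoid = record
            { isSemigroup = record { isMagma = isMagma _⊕_ ; assoc = Add.⊙-assoc ℕ.+-assoc }
            ; identity = comm∧idˡ⇒id ⊕-comm (Add.⊙-identityˡ ℕ.+-identityˡ)
            }
          ; inverse = comm∧invˡ⇒inv ⊕-comm ⊕-inverseˡ
          ; ⁻¹-cong = cong ⊝_
          }
        ; comm = ⊕-comm
        }
      ; *-cong = cong₂ _⊛_
      ; *-assoc = Mul.⊙-assoc ℕ.*-assoc
      ; *-identity = comm∧idˡ⇒id ⊛-comm (Mul.⊙-identityˡ ℕ.*-identityˡ)
      ; distrib = ⊛-distribˡ-⊕ , comm∧distrˡ⇒distrʳ ⊛-comm ⊛-distribˡ-⊕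
      }
    ; *-comm = ⊛-comm
    }
    where
    ⊕-comm : Commutative _≡_ _⊕_
    ⊕-comm = Add.⊙-comm ℕ.+-comm
    ⊛-comm : Commutative _≡_ _⊛_
    ⊛-comm = Mul.⊙-comm ℕ.*-comm

  commutativeRing : CommutativeRing 0ℓ 0ℓ
  commutativeRing = record { isCommutativeRing = isCommutativeRing }

  ⟦⟧-suc : ∀ k → ⟦ suc k ⟧ ≡ ⟦ k ⟧ ⊕ ⟦ 1 ⟧
  ⟦⟧-suc k = trans (cong ⟦_⟧ (ℕ.+-comm 1 k)) (sym (Add.⟦⟧-homo k 1))

  ⟦⟧-distinct : ∀ {i j} → i < n → j < n → i ≢ j → ⟦ i ⟧ ≢ ⟦ j ⟧
  ⟦⟧-distinct i<n j<n i≢j = i≢j ∘ ⟦⟧-injective i<n j<n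

  nonzero-avoiding : 4 ≤ n → ∀ a b → ∃[ c ] (c ≢ ⟦ 0 ⟧ × c ≢ a × c ≢ b)
  nonzero-avoiding 4≤n a b =
    pick (avoid-two _≟_ (distinct 1<4 2<4 λ ()) (distinct 1<4 3<4 λ ()) (distinct 2<4 3<4 λ ()) a b)
    where
    1<4 : 1 < 4
    1<4 = s<s z<s
    2<4 : 2 < 4
    2<4 = s<s (s<s z<s)
    3<4 : 3 < 4
    3<4 = s<s (s<s (s<s z<s))

    distinct : ∀ {i j} → i < 4 → j < 4 → i ≢ j → ⟦ i ⟧ ≢ ⟦ j ⟧
    distinct i<4 j<4 = ⟦⟧-distinct (ℕ.<-≤-trans i<4 4≤n) (ℕ.<-≤-trans j<4 4≤n)

    pick : (⟦ 1 ⟧ ≢ a × ⟦ 1 ⟧ ≢ b) ⊎ (⟦ 2 ⟧ ≢ a × ⟦ 2 ⟧ ≢ b) ⊎ (⟦ 3 ⟧ ≢ a × ⟦ 3 ⟧ ≢ b) →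
           ∃[ c ] (c ≢ ⟦ 0 ⟧ × c ≢ a × c ≢ b)
    pick (inj₁ avoids)        = ⟦ 1 ⟧ , distinct 1<4 z<s (λ ()) , avoids
    pick (inj₂ (inj₁ avoids)) = ⟦ 2 ⟧ , distinct 2<4 z<s (λ ()) , avoids
    pick (inj₂ (inj₂ avoids)) = ⟦ 3 ⟧ , distinct 3<4 z<s (λ ()) , avoids

module Cayley (n : ℕ) .{{_ : NonZero n}} where
  open CommutativeRing (ZMod.commutativeRing n) using (_-_; -_; 0#; ring)
  open RingProperties ring using (+-cancelʳ; x∙y⁻¹≈ε⇒x≈y; x≈y⇒x∙y⁻¹≈ε)
  open DifferenceProperties ring using (x-y≈x-z⇒y≈z)

  adj-horizontal : ∀ {p₁ p₂ q₁ q₂} → p₂ ≡ q₂ → p₁ ≢ q₁ → Adj n (p₁ , p₂) (q₁ , q₂)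
  adj-horizontal {p₁} {p₂} {q₁} p₂≡q₂ p₁≢q₁ =
    inj₁ (q₁ - p₁ , p₁≢q₁ ∘ sym ∘ x∙y⁻¹≈ε⇒x≈y q₁ p₁ , cong (q₁ - p₁ ,_) (x≈y⇒x∙y⁻¹≈ε (sym p₂≡q₂)))

  adj-vertical : ∀ {p₁ p₂ q₁ q₂} → p₁ ≡ q₁ → p₂ ≢ q₂ → Adj n (p₁ , p₂) (q₁ , q₂)
  adj-vertical {p₁} {p₂} {q₁} {q₂} p₁≡q₁ p₂≢q₂ =
    inj₂ (inj₁ (q₂ - p₂ , p₂≢q₂ ∘ sym ∘ x∙y⁻¹≈ε⇒x≈y q₂ p₂ , cong (_, q₂ - p₂) (x≈y⇒x∙y⁻¹≈ε (sym p₁≡q₁))))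

  adj-diagonal : ∀ {p₁ p₂ q₁ q₂} → q₁ - p₁ ≡ q₂ - p₂ → p₁ ≢ q₁ → Adj n (p₁ , p₂) (q₁ , q₂)
  adj-diagonal {p₁} {p₂} {q₁} eq p₁≢q₁ =
    inj₂ (inj₂ (q₁ - p₁ , p₁≢q₁ ∘ sym ∘ x∙y⁻¹≈ε⇒x≈y q₁ p₁ , cong (q₁ - p₁ ,_) (sym eq)))

  adj-cases : ∀ {p₁ p₂ q₁ q₂} → Adj n (p₁ , p₂) (q₁ , q₂) →
              p₂ ≡ q₂ ⊎ p₁ ≡ q₁ ⊎ q₁ - p₁ ≡ q₂ - p₂
  adj-cases {p₁} {p₂} {q₁} {q₂} (inj₁ (_ , _ , eq)) =
    inj₁ (sym (x∙y⁻¹≈ε⇒x≈y q₂ p₂ (cong proj₂ eq)))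
  adj-cases {p₁} {p₂} {q₁} {q₂} (inj₂ (inj₁ (_ , _ , eq))) =
    inj₂ (inj₁ (sym (x∙y⁻¹≈ε⇒x≈y q₁ p₁ (cong proj₁ eq))))
  adj-cases (inj₂ (inj₂ (_ , _ , eq))) =
    inj₂ (inj₂ (trans (cong proj₁ eq) (sym (cong proj₂ eq))))

  adj-to-diagonal : ∀ {x y c} → Adj n (x , y) (c , c) → x ≢ y → x ≡ c ⊎ y ≡ c
  adj-to-diagonal {x} {y} {c} adj x≢y with adj-cases adj
  ... | inj₁ y≡c        = inj₂ y≡c
  ... | inj₂ (inj₁ x≡c) = inj₁ x≡c
  ... | inj₂ (inj₂ eq)  = ⊥-elim (x≢y (x-y≈x-z⇒y≈z c x y eq))

  OffAxes : G n → Set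
  OffAxes (x , y) = x ≢ 0# × y ≢ 0# × x ≢ y

  OffAxes⇒¬adj-origin : ∀ {x y} → OffAxes (x , y) → ¬ Adj n (origin n) (x , y)
  OffAxes⇒¬adj-origin {x} {y} (x≢0 , y≢0 , x≢y) adj with adj-cases adj
  ... | inj₁ 0≡y        = y≢0 (sym 0≡y)
  ... | inj₂ (inj₁ 0≡x) = x≢0 (sym 0≡x)
  ... | inj₂ (inj₂ eq)  = x≢y (+-cancelʳ (- 0#) x y eq)

  ¬adj-origin⇒OffAxes : ∀ {x y} → (x , y) ≢ origin n → ¬ Adj n (origin n) (x , y) → OffAxes (x , y)
  ¬adj-origin⇒OffAxes {x} {y} ≢origin ¬adj = x≢0 , y≢0 , x≢y
    where
    x≢0 : x ≢ 0#
    x≢0 x≡0 with y ≟ 0#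
    ... | yes y≡0 = ≢origin (cong₂ _,_ x≡0 y≡0)
    ... | no y≢0  = ¬adj (adj-vertical (sym x≡0) (≢-sym y≢0))

    y≢0 : y ≢ 0#
    y≢0 y≡0 = ¬adj (adj-horizontal (sym y≡0) (≢-sym x≢0))

    x≢y : x ≢ y
    x≢y x≡y = ¬adj (adj-diagonal {0#} {0#} (cong (_- 0#) x≡y) (≢-sym x≢0))

module FixingAxes {n : ℕ} .{{_ : NonZero n}} {f : G n → G n}
  (f-aut : IsAut n f) (f-origin : f (origin n) ≡ origin n)
  (onto₁ : MapsOnto n f (C₁ n)) (onto₂ : MapsOnto n f (C₂ n)) (onto₃ : MapsOnto n f (C₃ n)) where

  open CommutativeRing (ZMod.commutativeRing n)
    using (_+_; _*_; _-_; -_; 0#; 1#; ring; +-comm; +-identityˡ; *-identityʳ; distribˡ; zeroʳ)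
  open RingProperties ring using (+-cancelʳ; +-identityˡ-unique; ⁻¹-anti-homo‿-; //-rightDividesʳ)
  open DifferenceProperties ring
  open Cayley n
  open ZMod n using (⟦_⟧; ⟦⟧-toℕ; ⟦⟧-suc; ⟦⟧-distinct; nonzero-avoiding)

  f-injective : ∀ {g h} → f g ≡ f h → g ≡ h
  f-injective = proj₁ (proj₁ f-aut)

  adj-image : ∀ {g h p q} → Adj n g h → f g ≡ p → f h ≡ q → Adj n p q
  adj-image {g} {h} g~h refl refl = Equivalence.to (proj₂ f-aut g h) g~h

  adj-preimage : ∀ {g h} → Adj n (f g) (f h) → Adj n g h
  adj-preimage {g} {h} = Equivalence.from (proj₂ f-aut g h)

  f-preserves-OffAxes : ∀ {g} → OffAxes g → OffAxes (f g)
  f-preserves-OffAxes {g} off = ¬adj-origin⇒OffAxes fg≢origin ¬adj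
    where
    fg≢origin : f g ≢ origin n
    fg≢origin eq = proj₁ off (cong proj₁ (f-injective (trans eq (sym f-origin))))

    ¬adj : ¬ Adj n (origin n) (f g)
    ¬adj adj = OffAxes⇒¬adj-origin off (adj-preimage (subst (λ o → Adj n o (f g)) (sym f-origin) adj))

  σ : ℤ n → ℤ n
  σ i = proj₁ (f (i , 0#))

  σ-zero : σ 0# ≡ 0#
  σ-zero = cong proj₁ f-origin

  f-axis₁ : ∀ i → f (i , 0#) ≡ (σ i , 0#)
  f-axis₁ i with i ≟ 0#
  ... | yes refl = cong (σ 0# ,_) (cong proj₂ f-origin)
  ... | no i≢0 with proj₁ onto₁ (i , 0#) (i , i≢0 , refl)
  ...   | _ , _ , eq = cong (σ i ,_) (cong proj₂ eq)

  σ-injective : ∀ {i j} → σ i ≡ σ j → i ≡ j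
  σ-injective {i} {j} eq =
    cong proj₁ (f-injective (trans (f-axis₁ i) (trans (cong (_, 0#) eq) (sym (f-axis₁ j)))))

  σ-nonzero : ∀ {i} → i ≢ 0# → σ i ≢ 0#
  σ-nonzero i≢0 eq = i≢0 (σ-injective (trans eq (sym σ-zero)))

  f-diagonal : ∀ i → f (i , i) ≡ (σ i , σ i)
  f-diagonal i with i ≟ 0#
  ... | yes refl = trans f-origin (sym (cong₂ _,_ σ-zero σ-zero))
  ... | no i≢0 with proj₁ onto₃ (i , i) (i , i≢0 , refl)
  ...   | y , y≢0 , eq with adj-cases (adj-image (adj-vertical refl (≢-sym i≢0)) (f-axis₁ i) eq)
  ...     | inj₁ 0≡y          = ⊥-elim (y≢0 (sym 0≡y))
  ...     | inj₂ (inj₁ σi≡y)  = trans eq (sym (cong₂ _,_ σi≡y σi≡y))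
  ...     | inj₂ (inj₂ eq′)   = ⊥-elim (σ-nonzero i≢0 (x-y≈x-z⇒y≈z y (σ i) 0# eq′))

  f-axis₂ : ∀ i → f (0# , i) ≡ (0# , σ i)
  f-axis₂ i with i ≟ 0#
  ... | yes refl = trans f-origin (cong (0# ,_) (sym σ-zero))
  ... | no i≢0 with proj₁ onto₂ (0# , i) (i , i≢0 , refl)
  ...   | y , y≢0 , eq
    with adj-to-diagonal (adj-image (adj-horizontal refl (≢-sym i≢0)) eq (f-diagonal i)) (≢-sym y≢0)
  ...     | inj₁ 0≡σi = ⊥-elim (σ-nonzero i≢0 (sym 0≡σi))
  ...     | inj₂ y≡σi = trans eq (cong (0# ,_) y≡σi)

  f-off-axes-cases : ∀ {a b} → OffAxes (a , b) → f (a , b) ≡ (σ a , σ b) ⊎ f (a , b) ≡ (σ b , σ a)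
  f-off-axes-cases {a} {b} off@(_ , _ , a≢b)
    with adj-to-diagonal (adj-image (adj-vertical refl (≢-sym a≢b)) refl (f-diagonal a))
                         (proj₂ (proj₂ (f-preserves-OffAxes off)))
       | adj-to-diagonal (adj-image (adj-horizontal refl a≢b) refl (f-diagonal b))
                         (proj₂ (proj₂ (f-preserves-OffAxes off)))
  ... | inj₁ x≡σa | inj₂ y≡σb = inj₁ (cong₂ _,_ x≡σa y≡σb)
  ... | inj₂ y≡σa | inj₁ x≡σb = inj₂ (cong₂ _,_ x≡σb y≡σa)
  ... | inj₁ x≡σa | inj₁ x≡σb = ⊥-elim (a≢b (σ-injective (trans (sym x≡σa) x≡σb)))
  ... | inj₂ y≡σa | inj₂ y≡σb = ⊥-elim (a≢b (σ-injective (trans (sym y≡σa) y≡σb)))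

  straight⇒σa-σ[a-b]≡σb : ∀ {a b} → OffAxes (a , b) → f (a , b) ≡ (σ a , σ b) → σ a - σ (a - b) ≡ σ b
  straight⇒σa-σ[a-b]≡σb {a} {b} (_ , b≢0 , _) straight
    with adj-cases (adj-image (adj-diagonal {a - b} {0#} (trans (x-[x-y]≈y a b) (sym (x-0≈x b)))
                                                         (b≢0 ∘ x-y≈x⇒y≈0 a b))
                              (f-axis₁ (a - b)) straight)
  ... | inj₁ 0≡σb      = ⊥-elim (σ-nonzero b≢0 (sym 0≡σb))
  ... | inj₂ (inj₁ eq) = ⊥-elim (b≢0 (x-y≈x⇒y≈0 a b (σ-injective eq)))
  ... | inj₂ (inj₂ eq) = trans eq (x-0≈x (σ b))

  swapped⇒σb-σa≡σa : ∀ {a b} → OffAxes (a , b) → f (a , b) ≡ (σ b , σ a) → σ b - σ a ≡ σ a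
  swapped⇒σb-σa≡σa {a} {b} (a≢0 , b≢0 , a≢b) swapped
    with adj-cases (adj-image (adj-vertical refl (≢-sym b≢0)) (f-axis₁ a) swapped)
  ... | inj₁ 0≡σa      = ⊥-elim (σ-nonzero a≢0 (sym 0≡σa))
  ... | inj₂ (inj₁ eq) = ⊥-elim (a≢b (σ-injective eq))
  ... | inj₂ (inj₂ eq) = trans eq (x-0≈x (σ a))

  swapped⇒b≡a+a : ∀ {a b} → OffAxes (a , b) → f (a , b) ≡ (σ b , σ a) → b ≡ a + a
  swapped⇒b≡a+a {a} {b} (a≢0 , b≢0 , a≢b) swapped
    with adj-cases (adj-image (adj-horizontal refl (≢-sym a≢0)) (f-axis₂ b) swapped)
       | adj-cases (adj-image (adj-diagonal {0#} {b - a} (trans (x-0≈x a) (sym (x-[x-y]≈y b a))) (≢-sym a≢0))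
                              (f-axis₂ (b - a)) swapped)
  ... | inj₁ σb≡σa       | _                = ⊥-elim (a≢b (sym (σ-injective σb≡σa)))
  ... | inj₂ (inj₁ 0≡σb) | _                = ⊥-elim (σ-nonzero b≢0 (sym 0≡σb))
  ... | _                | inj₂ (inj₁ 0≡σb) = ⊥-elim (σ-nonzero b≢0 (sym 0≡σb))
  ... | _                | inj₁ σ[b-a]≡σa   = x-y≈z⇒x≈z+y b a a (σ-injective σ[b-a]≡σa)
  ... | inj₂ (inj₂ eq)   | inj₂ (inj₂ eq′)  = ⊥-elim (a≢0 (x-y≈x⇒y≈0 b a (sym b≡b-a)))
    where
    b≡b-a : b ≡ b - a
    b≡b-a = σ-injective (x-y≈x-z⇒y≈z (σ a) (σ b) (σ (b - a)) (trans (sym eq) eq′))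

  module _ (4≤n : 4 ≤ n) where

    0<n : 0 < n
    0<n = ℕ.<-≤-trans z<s 4≤n

    1≢0 : 1# ≢ 0#
    1≢0 = ⟦⟧-distinct (ℕ.<-≤-trans (s<s z<s) 4≤n) 0<n λ ()

    never-swapped : ∀ {a b} → OffAxes (a , b) → f (a , b) ≢ (σ b , σ a)
    never-swapped {a} {b} off@(a≢0 , _ , a≢b) swapped with nonzero-avoiding 4≤n a b
    ... | c , c≢0 , c≢a , c≢b with f-off-axes-cases (a≢0 , c≢0 , ≢-sym c≢a)
    ...   | inj₂ swapped′ =
      c≢b (trans (swapped⇒b≡a+a (a≢0 , c≢0 , ≢-sym c≢a) swapped′) (sym (swapped⇒b≡a+a off swapped)))
    ...   | inj₁ straight
      with adj-cases (adj-image (adj-vertical {a} {b} {a} {c} refl (≢-sym c≢b)) swapped straight)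
    ...     | inj₁ σa≡σc        = c≢a (σ-injective (sym σa≡σc))
    ...     | inj₂ (inj₁ σb≡σa) = a≢b (σ-injective (sym σb≡σa))
    ...     | inj₂ (inj₂ eq)    = σ-nonzero c≢0 (+-cancelʳ (- σ a) (σ c) 0# (begin
      σ c - σ a      ≡⟨ eq ⟨
      σ a - σ b      ≡⟨ ⁻¹-anti-homo‿- (σ b) (σ a) ⟨
      - (σ b - σ a)  ≡⟨ cong -_ (swapped⇒σb-σa≡σa off swapped) ⟩
      - σ a          ≡⟨ +-identityˡ (- σ a) ⟨
      0# - σ a       ∎))
      where open ≡-Reasoning

    f-off-axes : ∀ {a b} → OffAxes (a , b) → f (a , b) ≡ (σ a , σ b)
    f-off-axes off with f-off-axes-cases off
    ... | inj₁ straight = straight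
    ... | inj₂ swapped  = ⊥-elim (never-swapped off swapped)

    σ[x+1]≡σx+σ1 : ∀ x → x + 1# ≢ 0# → σ (x + 1#) ≡ σ x + σ 1#
    σ[x+1]≡σx+σ1 x x+1≢0 with x ≟ 0#
    ... | yes refl = begin
      σ (0# + 1#)   ≡⟨ cong σ (+-identityˡ 1#) ⟩
      σ 1#          ≡⟨ +-identityˡ (σ 1#) ⟨
      0# + σ 1#     ≡⟨ cong (_+ σ 1#) σ-zero ⟨
      σ 0# + σ 1#   ∎
      where open ≡-Reasoning
    ... | no x≢0 = begin
      σ (x + 1#)               ≡⟨ x-y≈z⇒x≈z+y _ _ _ (straight⇒σa-σ[a-b]≡σb off (f-off-axes off)) ⟩
      σ 1# + σ (x + 1# - 1#)   ≡⟨ cong (λ t → σ 1# + σ t) (//-rightDividesʳ 1# x) ⟩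
      σ 1# + σ x               ≡⟨ +-comm (σ 1#) (σ x) ⟩
      σ x + σ 1#               ∎
      where
      open ≡-Reasoning
      off : OffAxes (x + 1# , 1#)
      off = x+1≢0 , 1≢0 , x≢0 ∘ +-identityˡ-unique x 1#

    σ-linear-⟦⟧ : ∀ k → k < n → σ ⟦ k ⟧ ≡ σ 1# * ⟦ k ⟧
    σ-linear-⟦⟧ zero    _     = trans σ-zero (sym (zeroʳ (σ 1#)))
    σ-linear-⟦⟧ (suc k) 1+k<n = begin
      σ ⟦ suc k ⟧               ≡⟨ cong σ (⟦⟧-suc k) ⟩
      σ (⟦ k ⟧ + 1#)            ≡⟨ σ[x+1]≡σx+σ1 ⟦ k ⟧ ⟦k⟧+1≢0 ⟩
      σ ⟦ k ⟧ + σ 1#            ≡⟨ cong₂ _+_ (σ-linear-⟦⟧ k k<n) (sym (*-identityʳ (σ 1#))) ⟩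
      σ 1# * ⟦ k ⟧ + σ 1# * 1#  ≡⟨ distribˡ (σ 1#) ⟦ k ⟧ 1# ⟨
      σ 1# * (⟦ k ⟧ + 1#)       ≡⟨ cong (σ 1# *_) (⟦⟧-suc k) ⟨
      σ 1# * ⟦ suc k ⟧          ∎
      where
      open ≡-Reasoning
      k<n : k < n
      k<n = ℕ.<-trans (ℕ.n<1+n k) 1+k<n
      ⟦k⟧+1≢0 : ⟦ k ⟧ + 1# ≢ 0#
      ⟦k⟧+1≢0 = subst (_≢ 0#) (⟦⟧-suc k) (⟦⟧-distinct 1+k<n 0<n λ ())

    σ-linear : ∀ x → σ x ≡ σ 1# * x
    σ-linear x = begin
      σ x                ≡⟨ cong σ (⟦⟧-toℕ x) ⟨
      σ ⟦ toℕ x ⟧        ≡⟨ σ-linear-⟦⟧ (toℕ x) (toℕ<n x) ⟩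
      σ 1# * ⟦ toℕ x ⟧   ≡⟨ cong (σ 1# *_) (⟦⟧-toℕ x) ⟩
      σ 1# * x           ∎
      where open ≡-Reasoning

    σ1-isUnit : IsUnit n (σ 1#)
    σ1-isUnit with proj₂ onto₁ (1# , 0#) (1# , 1≢0 , refl)
    ... | _ , (i , _ , refl) , fi≡1 = i , trans (sym (σ-linear i)) (cong proj₁ fi≡1)

    f≗ψσ1 : ∀ g → f g ≡ ψ n (σ 1#) g
    f≗ψσ1 (a , b) with b ≟ 0# | a ≟ 0# | a ≟ b
    ... | yes refl | _        | _        = trans (f-axis₁ a) (cong₂ _,_ (σ-linear a) (sym (zeroʳ (σ 1#))))
    ... | no _     | yes refl | _        = trans (f-axis₂ b) (cong₂ _,_ (sym (zeroʳ (σ 1#))) (σ-linear b))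
    ... | no _     | no _     | yes refl = trans (f-diagonal a) (cong₂ _,_ (σ-linear a) (σ-linear a))
    ... | no b≢0   | no a≢0   | no a≢b   =
      trans (f-off-axes (a≢0 , b≢0 , a≢b)) (cong₂ _,_ (σ-linear a) (σ-linear b))

lemma2p1 : (n : ℕ) → .{{nz : NonZero n}} → 4 ≤ n → (f : G n → G n) →
    IsAut n f → f (origin n) ≡ origin n →
    MapsOnto n f (C₁ n) → MapsOnto n f (C₂ n) → MapsOnto n f (C₃ n) →
    ∃[ u ] (IsUnit n u × (∀ g → f g ≡ ψ n u g))
lemma2p1 n 4≤n f f-aut f-origin onto₁ onto₂ onto₃ = σ (one' n) , σ1-isUnit 4≤n , f≗ψσ1 4≤n
  where open FixingAxes f-aut f-origin onto₁ onto₂ onto₃
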